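{- Let $G = (V,E)$ be a graph and $c \geq 0$. Suppose $G$ has two connected spanning subgraphs $G_1 = (V, E_1)$ and $G_2 = (V, E_2)$ such that $|E_1 \cap E_2| \leq c$. Then $rc(G) \leq diam(G_1) + diam(G_2) + c$.
   Context: An edge colouring of a graph $G$ is called rainbow if between any two vertices of $G$ there is a path all of whose edges have distinct colours. The rainbow connectivity $rc(G)$ of a connected graph $G$ is the minimum number of colours in a rainbow edge colouring of $G$. $diam(H)$ denotes the diameter of a connected graph $H$. -}

module Defs where

open import Data.Nat using (ℕ; zero; suc; _+_; _≤_; _<ᵇ_)
open import Data.Fin using (Fin; toℕ)
open import Data.Bool using (Bool; true; false; _∧_)
open import Data.List using (List; []; _∷_; length; filterᵇ; cartesianProduct; allFin)
open import Data.List.Relation.Unary.Unique.Propositional using (Unique)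
open import Data.Product using (Σ; _×_; _,_; ∃; ∃-syntax)
open import Relation.Binary.PropositionalEquality using (_≡_)

EdgeRel : ℕ → Set
EdgeRel n = Fin n → Fin n → Bool

record Graph (n : ℕ) : Set where
  field
    E     : EdgeRel n
    sym   : ∀ u v → E u v ≡ true → E v u ≡ true
    irrefl : ∀ u → E u u ≡ false
open Graph public

SpanningSubgraph : ∀ {n} → Graph n → Graph n → Set
SpanningSubgraph {n} H G = ∀ (u v : Fin n) → E H u v ≡ true → E G u v ≡ true

data Walk {n : ℕ} (R : EdgeRel n) : Fin n → Fin n → Set where
  []  : ∀ {u} → Walk R u u
  _∷_ : ∀ {u v w} → R u v ≡ true → Walk R v w → Walk R u w

walkLength : ∀ {n} {R : EdgeRel n} {u v} → Walk R u v → ℕ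
walkLength []      = 0
walkLength (_ ∷ w) = suc (walkLength w)

vertices : ∀ {n} {R : EdgeRel n} {u v} → Walk R u v → List (Fin n)
vertices {u = u} []      = u ∷ []
vertices {u = u} (_ ∷ w) = u ∷ vertices w

IsPath : ∀ {n} {R : EdgeRel n} {u v} → Walk R u v → Set
IsPath w = Unique (vertices w)

Connected : ∀ {n} → Graph n → Set
Connected {n} G = ∀ (u v : Fin n) → Walk (E G) u v

IsDist : ∀ {n} → Graph n → Fin n → Fin n → ℕ → Set
IsDist G u v d =
  Σ (Walk (E G) u v) (λ w → walkLength w ≡ d) ×
  (∀ (w : Walk (E G) u v) → d ≤ walkLength w)

IsDiam : ∀ {n} → Graph n → ℕ → Set
IsDiam {n} G d =
  (∀ (u v : Fin n) → ∃[ d' ] (IsDist G u v d' × d' ≤ d)) ×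
  (∃[ u ] ∃[ v ] IsDist G u v d)

record EdgeColouring {n : ℕ} (G : Graph n) (k : ℕ) : Set where
  field
    col    : ∀ (u v : Fin n) → E G u v ≡ true → Fin k
    colSym : ∀ u v (p : E G u v ≡ true) (q : E G v u ≡ true) → col u v p ≡ col v u q
open EdgeColouring public

colours : ∀ {n k} {G : Graph n} (χ : EdgeColouring G k) {u v} → Walk (E G) u v → List (Fin k)
colours χ []            = []
colours χ (_∷_ {u} {v} p w) = col χ u v p ∷ colours χ w

IsRainbow : ∀ {n k} {G : Graph n} → EdgeColouring G k → Set
IsRainbow {n} {G = G} χ =
  ∀ (u v : Fin n) → Σ (Walk (E G) u v) (λ w → IsPath w × Unique (colours χ w))

RcLe : ∀ {n} → Graph n → ℕ → Set
RcLe G m = ∃[ k ] (k ≤ m × Σ (EdgeColouring G k) IsRainbow)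

commonEdges : ∀ {n} → Graph n → Graph n → ℕ
commonEdges {n} H₁ H₂ =
  length (filterᵇ (λ { (u , v) → (toℕ u <ᵇ toℕ v) ∧ (E H₁ u v ∧ E H₂ u v) })
                  (cartesianProduct (allFin n) (allFin n)))

-- Fix a root r and take BFS layers from r in G₁ and in G₂. An edge lying in both
-- subgraphs gets a private colour (at most c of these); any other edge of G₁ gets the
-- G₁-layer of its upper endpoint (d₁ colours), and every remaining edge the G₂-layer of
-- its upper endpoint (d₂ colours). Given u and v, follow a shortest G₂-path from v
-- towards r until it first meets a shortest G₁-path P from u to r at a vertex t; the
-- segment of P from u to t followed by the reversed G₂-segment from t to v is a path.
-- Along the first part the G₁-layers strictly decrease, along the second the G₂-layers
-- strictly increase, the private colours never repeat, so the path is rainbow.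
module Submission where

open import Defs hiding (sym; irrefl)
open import Data.Bool using (Bool; true; false; T; _∧_)
open import Data.Bool.Properties using (T-≡; T-∧)
open import Data.Empty using (⊥; ⊥-elim)
open import Data.Fin using (Fin; toℕ; fromℕ<)
open import Data.Fin.Properties using (toℕ-injective; toℕ-fromℕ<; toℕ<n) renaming (_≟_ to _≟ᶠ_)
open import Data.List using (List; []; _∷_; map; length; filterᵇ; cartesianProduct; allFin)
open import Data.List.Membership.Propositional using (_∈_; _∉_)
open import Data.List.Membership.Propositional.Properties
  using (∈-map⁻; ∈-filter⁺; ∈-cartesianProduct⁺; ∈-allFin)
import Data.List.Membership.Setoid.Properties as Membershipₛ
import Data.List.Membership.DecPropositional as DecMembership
open import Data.List.Relation.Unary.All as All using (All; []; _∷_)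
import Data.List.Relation.Unary.All.Properties as All
open import Data.List.Relation.Unary.Any using (here; there; index)
open import Data.List.Relation.Unary.AllPairs using ([]; _∷_)
open import Data.List.Relation.Unary.Unique.Propositional using (Unique)
import Data.List.Relation.Unary.Unique.Propositional.Properties as Unique
open import Data.Nat using (ℕ; zero; suc; pred; _+_; _⊔_; _≤_; _<_; _<ᵇ_; z≤n; s≤s; s≤s⁻¹)
open import Data.Nat.Properties
open import Data.Product using (Σ; _×_; _,_; proj₁; proj₂; ∃-syntax; uncurry)
open import Data.Product.Properties using (≡-dec; ,-injectiveˡ; ,-injectiveʳ)
import Data.Product as Product
open import Data.Sum using (_⊎_; inj₁; inj₂)
import Data.Sum as Sum
open import Data.Unit using (⊤; tt)
open import Function using (_∘_; Equivalence)
open import Relation.Binary.PropositionalEquality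
open import Relation.Nullary using (¬_; yes; no)

unique-map⁺-on : ∀ {A B : Set} {P : A → Set} {f : A → B}
            → (∀ {x y} → P x → P y → f x ≡ f y → x ≡ y)
            → ∀ {xs} → All P xs → Unique xs → Unique (map f xs)
unique-map⁺-on inj []         []           = []
unique-map⁺-on inj (px ∷ pxs) (x∉xs ∷ xs!) =
  All.map⁺ (All.zipWith (λ (py , x≢y) → x≢y ∘ inj px py) (pxs , x∉xs)) ∷ unique-map⁺-on inj pxs xs!

∉⇒≢ : ∀ {A : Set} {x y : A} {xs} → x ∉ xs → y ∈ xs → x ≢ y
∉⇒≢ x∉xs y∈xs refl = x∉xs y∈xs

module _ {n : ℕ} (H : Graph n) where

  E-comm : ∀ a b → E H a b ≡ E H b a
  E-comm a b with E H a b in ab | E H b a in ba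
  ... | true  | true  = refl
  ... | false | false = refl
  ... | true  | false with () ← trans (sym (Graph.sym H a b ab)) ba
  ... | false | true  with () ← trans (sym (Graph.sym H b a ba)) ab

  edge⇒≢ : ∀ {a b} → E H a b ≡ true → a ≢ b
  edge⇒≢ {a} e refl with () ← trans (sym e) (Graph.irrefl H a)

module _ {n : ℕ} {R : EdgeRel n} where

  edges : ∀ {x y} → Walk R x y → List (Fin n × Fin n)
  edges []                = []
  edges (_∷_ {x} {y} _ w) = (x , y) ∷ edges w

  source∈vertices : ∀ {x y} (w : Walk R x y) → x ∈ vertices w
  source∈vertices []      = here refl
  source∈vertices (_ ∷ _) = here refl

  target∈vertices : ∀ {x y} (w : Walk R x y) → y ∈ vertices w
  target∈vertices []      = here refl
  target∈vertices (_ ∷ w) = there (target∈vertices w)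

  ∈-edges⇒∈-vertices : ∀ {x y a b} (w : Walk R x y) → (a , b) ∈ edges w
                     → a ∈ vertices w × b ∈ vertices w
  ∈-edges⇒∈-vertices (_ ∷ w) (here refl) = here refl , there (source∈vertices w)
  ∈-edges⇒∈-vertices (_ ∷ w) (there ab∈) = Product.map there there (∈-edges⇒∈-vertices w ab∈)

  edges-related : ∀ {x y} (w : Walk R x y) → All (uncurry λ a b → R a b ≡ true) (edges w)
  edges-related []      = []
  edges-related (e ∷ w) = e ∷ edges-related w

  walkLength≡0⇒≡ : ∀ {x y} (w : Walk R x y) → walkLength w ≡ 0 → x ≡ y
  walkLength≡0⇒≡ [] _ = refl

  Descending : (Fin n → ℕ) → ∀ {x y} → Walk R x y → Set
  Descending h []                = ⊤
  Descending h (_∷_ {x} {y} _ w) = h x ≡ suc (h y) × Descending h w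

  descending⇒≤source : ∀ h {x y} (w : Walk R x y) → Descending h w
                     → ∀ {s} → s ∈ vertices w → h s ≤ h x
  descending⇒≤source h []      _         (here refl) = ≤-refl
  descending⇒≤source h []      _         (there ())
  descending⇒≤source h (_ ∷ w) _         (here refl) = ≤-refl
  descending⇒≤source h (_ ∷ w) (hx , w↓) (there s∈w) =
    ≤-trans (descending⇒≤source h w w↓ s∈w) (≤-trans (n≤1+n _) (≤-reflexive (sym hx)))

  higher∉descending : ∀ h {x y s} (w : Walk R x y) → Descending h w → h x < h s → s ∉ vertices w
  higher∉descending h w w↓ hx<hs s∈w = <⇒≱ hx<hs (descending⇒≤source h w w↓ s∈w)

module Levels {n : ℕ} (H : Graph n) {d : ℕ} (diam : IsDiam H d) (r : Fin n) where

  private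
    distance : ∀ x → ∃[ k ] (IsDist H x r k × k ≤ d)
    distance x = proj₁ diam x r

  level : Fin n → ℕ
  level x = proj₁ (distance x)

  level≤diam : ∀ x → level x ≤ d
  level≤diam x = proj₂ (proj₂ (distance x))

  geodesic : ∀ x → Walk (E H) x r
  geodesic x = proj₁ (proj₁ (proj₁ (proj₂ (distance x))))

  private
    geodesic-length : ∀ x → walkLength (geodesic x) ≡ level x
    geodesic-length x = proj₂ (proj₁ (proj₁ (proj₂ (distance x))))

    level-minimal : ∀ x (w : Walk (E H) x r) → level x ≤ walkLength w
    level-minimal x = proj₂ (proj₁ (proj₂ (distance x)))

  shortest⇒descending : ∀ {x} (w : Walk (E H) x r) → walkLength w ≡ level x → Descending level w
  shortest⇒descending []                _          = tt
  shortest⇒descending (_∷_ {x} {z} e w) 1+len≡lev = trans (sym 1+len≡lev) (cong suc len≡lev)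
                                                  , shortest⇒descending w len≡lev
    where
      via-z : level x ≤ suc (level z)
      via-z = subst (level x ≤_) (cong suc (geodesic-length z)) (level-minimal x (e ∷ geodesic z))

      len≡lev : walkLength w ≡ level z
      len≡lev = ≤-antisym (s≤s⁻¹ (subst (_≤ suc (level z)) (sym 1+len≡lev) via-z))
                          (level-minimal z w)

  geodesic-descending : ∀ x → Descending level (geodesic x)
  geodesic-descending x = shortest⇒descending (geodesic x) (geodesic-length x)

  level≡0⇒≡root : ∀ {x} → level x ≡ 0 → x ≡ r
  level≡0⇒≡root {x} lev≡0 = walkLength≡0⇒≡ (geodesic x) (trans (geodesic-length x) lev≡0)

  level-⊔-positive : ∀ {a b} → a ≢ b → 0 < level a ⊔ level b
  level-⊔-positive {a} {b} a≢b with level a in la | level b in lb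
  ... | suc k | l     = ≤-trans (s≤s z≤n) (m≤m⊔n (suc k) l)
  ... | zero  | suc l = s≤s z≤n
  ... | zero  | zero  = ⊥-elim (a≢b (trans (level≡0⇒≡root la) (sym (level≡0⇒≡root lb))))

module _ {n : ℕ} where

  sortedPair : Fin n → Fin n → Fin n × Fin n
  sortedPair a b with toℕ a <ᵇ toℕ b
  ... | true  = a , b
  ... | false = b , a

  sortedPair-view : ∀ a b → (sortedPair a b ≡ (a , b) × toℕ a < toℕ b)
                          ⊎ (sortedPair a b ≡ (b , a) × toℕ b ≤ toℕ a)
  sortedPair-view a b with toℕ a <ᵇ toℕ b in a<ᵇb
  ... | true  = inj₁ (refl , <ᵇ⇒< _ _ (Equivalence.from T-≡ a<ᵇb))
  ... | false = inj₂ (refl , ≮⇒≥ λ a<b → subst T a<ᵇb (<⇒<ᵇ a<b))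

  sortedPair-comm : ∀ a b → sortedPair a b ≡ sortedPair b a
  sortedPair-comm a b with sortedPair-view a b | sortedPair-view b a
  ... | inj₁ (_ , a<b) | inj₁ (_ , b<a) = ⊥-elim (<-asym a<b b<a)
  ... | inj₁ (p , _)   | inj₂ (q , _)   = trans p (sym q)
  ... | inj₂ (p , _)   | inj₁ (q , _)   = trans p (sym q)
  ... | inj₂ (_ , b≤a) | inj₂ (_ , a≤b) rewrite toℕ-injective (≤-antisym a≤b b≤a) = refl

  sortedPair-≡⇒ : ∀ {y z a b} → sortedPair y z ≡ sortedPair a b → y ≡ a ⊎ y ≡ b
  sortedPair-≡⇒ {y} {z} {a} {b} eq with sortedPair-view y z | sortedPair-view a b
  ... | inj₁ (p , _) | inj₁ (q , _) = inj₁ (,-injectiveˡ (trans (sym p) (trans eq q)))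
  ... | inj₁ (p , _) | inj₂ (q , _) = inj₂ (,-injectiveˡ (trans (sym p) (trans eq q)))
  ... | inj₂ (p , _) | inj₁ (q , _) = inj₂ (,-injectiveʳ (trans (sym p) (trans eq q)))
  ... | inj₂ (p , _) | inj₂ (q , _) = inj₁ (,-injectiveʳ (trans (sym p) (trans eq q)))

data Layer : Set where
  first second : ℕ → Layer

data Colour (n : ℕ) : Set where
  shared : Fin n × Fin n → Colour n
  layer  : Layer → Colour n

data Classified {n : ℕ} (Λ : Layer → Set) (a b : Fin n) : Colour n → Set where
  shared-edge : Classified Λ a b (shared (sortedPair a b))
  in-layer    : ∀ {l} → Λ l → Classified Λ a b (layer l)

shared-injective : ∀ {n} {e e′ : Fin n × Fin n} → shared e ≡ shared e′ → e ≡ e′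
shared-injective refl = refl

module _ {n : ℕ} {Λ : Layer → Set} where

  classified-mono : ∀ {Λ′} {a b : Fin n} {κ} → (∀ {l} → Λ l → Λ′ l)
                  → Classified Λ a b κ → Classified Λ′ a b κ
  classified-mono _ shared-edge   = shared-edge
  classified-mono f (in-layer Λl) = in-layer (f Λl)

  classified-distinct : ∀ {l} {x y a b : Fin n} {κ κ′} → x ≢ a → x ≢ b → ¬ Λ l
                      → Classified (_≡ l) x y κ → Classified Λ a b κ′ → κ ≢ κ′
  classified-distinct x≢a x≢b _ shared-edge shared-edge eq =
    Sum.[ x≢a , x≢b ] (sortedPair-≡⇒ (shared-injective eq))
  classified-distinct _ _ _   shared-edge     (in-layer _)  ()
  classified-distinct _ _ _   (in-layer _)    shared-edge   ()
  classified-distinct _ _ ¬Λl (in-layer refl) (in-layer Λl) refl = ¬Λl Λl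

FirstAtMost : ℕ → Layer → Set
FirstAtMost k (first j)  = j ≤ k
FirstAtMost k (second _) = ⊤

SecondAbove : ℕ → Layer → Set
SecondAbove k (first _)  = ⊥
SecondAbove k (second j) = k < j

FirstAtMost-mono : ∀ {k k′} → k ≤ k′ → ∀ {l} → FirstAtMost k l → FirstAtMost k′ l
FirstAtMost-mono k≤k′ {first _}  j≤k = ≤-trans j≤k k≤k′
FirstAtMost-mono k≤k′ {second _} _   = tt

SecondAbove-mono : ∀ {k k′} → k ≤ k′ → ∀ {l} → SecondAbove k′ l → SecondAbove k l
SecondAbove-mono k≤k′ {second _} k′<j = ≤-<-trans k≤k′ k′<j

SecondAbove⇒FirstAtMost : ∀ {k k′ l} → SecondAbove k l → FirstAtMost k′ l
SecondAbove⇒FirstAtMost {l = second _} _ = tt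

module Palette {n : ℕ} (d₁ d₂ : ℕ) (pairs : List (Fin n × Fin n)) where

  open DecMembership (≡-dec (_≟ᶠ_ {n}) (_≟ᶠ_ {n})) using (_∈?_)

  position : Fin n × Fin n → ℕ
  position e with e ∈? pairs
  ... | yes e∈ = toℕ (index e∈)
  ... | no  _  = 0

  position-< : ∀ {e} → e ∈ pairs → position e < length pairs
  position-< {e} e∈ with e ∈? pairs
  ... | yes e∈′ = toℕ<n (index e∈′)
  ... | no  e∉  = ⊥-elim (e∉ e∈)

  position-injective : ∀ {e e′} → e ∈ pairs → e′ ∈ pairs → position e ≡ position e′ → e ≡ e′
  position-injective {e} {e′} e∈ e′∈ eq with e ∈? pairs | e′ ∈? pairs
  ... | yes p | yes q = Membershipₛ.index-injective (setoid (Fin n × Fin n)) p q (toℕ-injective eq)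
  ... | no e∉ | _     = ⊥-elim (e∉ e∈)
  ... | yes _ | no e′∉ = ⊥-elim (e′∉ e′∈)

  -- Layer colours are indexed by the level of the upper endpoint of an edge, which is
  -- positive: level k ∈ [1, dᵢ] is encoded by k - 1.
  data Admissible : Colour n → Set where
    in-pairs     : ∀ {e} → e ∈ pairs → Admissible (shared e)
    first-layer  : ∀ {k} → k < d₁ → Admissible (layer (first (suc k)))
    second-layer : ∀ {k} → k < d₂ → Admissible (layer (second (suc k)))

  first-admissible : ∀ {k} → 0 < k → k ≤ d₁ → Admissible (layer (first k))
  first-admissible (s≤s z≤n) k≤d₁ = first-layer k≤d₁

  second-admissible : ∀ {k} → 0 < k → k ≤ d₂ → Admissible (layer (second k))
  second-admissible (s≤s z≤n) k≤d₂ = second-layer k≤d₂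

  encode : Colour n → ℕ
  encode (shared e)         = d₁ + d₂ + position e
  encode (layer (first k))  = pred k
  encode (layer (second k)) = d₁ + pred k

  encode-< : ∀ {κ} → Admissible κ → encode κ < d₁ + d₂ + length pairs
  encode-< (in-pairs e∈)      = +-monoʳ-< (d₁ + d₂) (position-< e∈)
  encode-< (first-layer k<d)  = <-≤-trans k<d (≤-trans (m≤m+n d₁ d₂) (m≤m+n _ _))
  encode-< (second-layer k<d) = <-≤-trans (+-monoʳ-< d₁ k<d) (m≤m+n _ _)

  private
    below≢offset : ∀ {k m j} → k < m → k ≢ m + j
    below≢offset {m = m} {j} k<m refl = <⇒≱ k<m (m≤m+n m j)

    first≢shared : ∀ {k p} → k < d₁ → k ≢ d₁ + d₂ + p
    first≢shared k<d₁ eq = below≢offset k<d₁ (trans eq (+-assoc d₁ d₂ _))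

    second≢shared : ∀ {k p} → k < d₂ → d₁ + k ≢ d₁ + d₂ + p
    second≢shared k<d₂ eq = below≢offset k<d₂ (+-cancelˡ-≡ d₁ _ _ (trans eq (+-assoc d₁ d₂ _)))

  encode-injective : ∀ {κ κ′} → Admissible κ → Admissible κ′ → encode κ ≡ encode κ′ → κ ≡ κ′
  encode-injective (in-pairs p)      (in-pairs q)       eq   =
    cong shared (position-injective p q (+-cancelˡ-≡ (d₁ + d₂) _ _ eq))
  encode-injective (first-layer _)    (first-layer _)    refl = refl
  encode-injective (second-layer _)   (second-layer _)   eq   =
    cong (layer ∘ second ∘ suc) (+-cancelˡ-≡ d₁ _ _ eq)
  encode-injective (first-layer k<d)  (second-layer _)   eq = ⊥-elim (below≢offset k<d eq)
  encode-injective (second-layer _)   (first-layer k<d)  eq = ⊥-elim (below≢offset k<d (sym eq))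
  encode-injective (first-layer k<d)  (in-pairs _)       eq = ⊥-elim (first≢shared k<d eq)
  encode-injective (in-pairs _)       (first-layer k<d)  eq = ⊥-elim (first≢shared k<d (sym eq))
  encode-injective (second-layer k<d) (in-pairs _)       eq = ⊥-elim (second≢shared k<d eq)
  encode-injective (in-pairs _)       (second-layer k<d) eq = ⊥-elim (second≢shared k<d (sym eq))

module TwoSpanningSubgraphs {n : ℕ} (G G₁ G₂ : Graph n)
  (G₁⊆G : SpanningSubgraph G₁ G) (G₂⊆G : SpanningSubgraph G₂ G)
  {d₁ d₂ : ℕ} (diam₁ : IsDiam G₁ d₁) (diam₂ : IsDiam G₂ d₂) where

  -- Any vertex serves as the common root of the two layerings.
  root : Fin n
  root = proj₁ (proj₂ diam₁)

  open Levels G₁ diam₁ root using () renaming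
    (level to level₁; level≤diam to level₁≤d₁; geodesic to geodesic₁;
     geodesic-descending to geodesic₁-descending; level-⊔-positive to level₁-⊔-positive)
  open Levels G₂ diam₂ root using () renaming
    (level to level₂; level≤diam to level₂≤d₂; geodesic to geodesic₂;
     geodesic-descending to geodesic₂-descending; level-⊔-positive to level₂-⊔-positive)

  isCommonPair : Fin n × Fin n → Bool
  isCommonPair (a , b) = (toℕ a <ᵇ toℕ b) ∧ (E G₁ a b ∧ E G₂ a b)

  commonPairs : List (Fin n × Fin n)
  commonPairs = filterᵇ isCommonPair (cartesianProduct (allFin n) (allFin n))

  length-commonPairs : length commonPairs ≡ commonEdges G₁ G₂
  length-commonPairs = refl

  ordered∈commonPairs : ∀ {a b} → toℕ a < toℕ b → E G₁ a b ≡ true → E G₂ a b ≡ true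
                      → (a , b) ∈ commonPairs
  ordered∈commonPairs {a} {b} a<b e₁ e₂ =
    ∈-filter⁺ _ (∈-cartesianProduct⁺ (∈-allFin a) (∈-allFin b))
      (Equivalence.from T-∧ (<⇒<ᵇ a<b , Equivalence.from T-∧ (true⇒T e₁ , true⇒T e₂)))
    where
      true⇒T : ∀ {β} → β ≡ true → T β
      true⇒T = Equivalence.from T-≡

  sortedPair∈commonPairs : ∀ {a b} → a ≢ b → E G₁ a b ≡ true → E G₂ a b ≡ true
                         → sortedPair a b ∈ commonPairs
  sortedPair∈commonPairs {a} {b} a≢b e₁ e₂ with sortedPair-view a b
  ... | inj₁ (p , a<b) = subst (_∈ commonPairs) (sym p) (ordered∈commonPairs a<b e₁ e₂)
  ... | inj₂ (p , b≤a) = subst (_∈ commonPairs) (sym p)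
      (ordered∈commonPairs (≤∧≢⇒< b≤a (a≢b ∘ sym ∘ toℕ-injective))
                           (Graph.sym G₁ a b e₁) (Graph.sym G₂ a b e₂))

  colourBy : Bool → Bool → Fin n → Fin n → Colour n
  colourBy true  true  a b = shared (sortedPair a b)
  colourBy true  false a b = layer (first (level₁ a ⊔ level₁ b))
  colourBy false _     a b = layer (second (level₂ a ⊔ level₂ b))

  colour : Fin n → Fin n → Colour n
  colour a b = colourBy (E G₁ a b) (E G₂ a b) a b

  colour-comm : ∀ a b → colour a b ≡ colour b a
  colour-comm a b = trans (colourBy-comm (E G₁ a b) (E G₂ a b))
                          (cong₂ (λ β γ → colourBy β γ b a) (E-comm G₁ a b) (E-comm G₂ a b))
    where
      colourBy-comm : ∀ β γ → colourBy β γ a b ≡ colourBy β γ b a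
      colourBy-comm true  true  = cong shared (sortedPair-comm a b)
      colourBy-comm true  false = cong (layer ∘ first) (⊔-comm (level₁ a) (level₁ b))
      colourBy-comm false _     = cong (layer ∘ second) (⊔-comm (level₂ a) (level₂ b))

  classify₁ : ∀ {a b} → E G₁ a b ≡ true
            → Classified (_≡ first (level₁ a ⊔ level₁ b)) a b (colour a b)
  classify₁ {a} {b} = by (E G₁ a b) (E G₂ a b)
    where
      by : ∀ β γ → β ≡ true → Classified (_≡ first (level₁ a ⊔ level₁ b)) a b (colourBy β γ a b)
      by true true  _ = shared-edge
      by true false _ = in-layer refl

  classify₂ : ∀ {a b} → E G₂ a b ≡ true
            → Classified (_≡ second (level₂ a ⊔ level₂ b)) a b (colour a b)
  classify₂ {a} {b} = by (E G₁ a b) (E G₂ a b)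
    where
      by : ∀ β γ → γ ≡ true → Classified (_≡ second (level₂ a ⊔ level₂ b)) a b (colourBy β γ a b)
      by true  true _ = shared-edge
      by false _    _ = in-layer refl

  open Palette d₁ d₂ commonPairs

  colour-admissible : ∀ {a b} → E G a b ≡ true → Admissible (colour a b)
  colour-admissible {a} {b} e = by (E G₁ a b) (E G₂ a b) (sortedPair∈commonPairs a≢b)
    where
      a≢b : a ≢ b
      a≢b = edge⇒≢ G e

      by : ∀ β γ → (β ≡ true → γ ≡ true → sortedPair a b ∈ commonPairs)
         → Admissible (colourBy β γ a b)
      by true  true  common = in-pairs (common refl refl)
      by true  false _      =
        first-admissible (level₁-⊔-positive a≢b) (⊔-lub (level₁≤d₁ a) (level₁≤d₁ b))
      by false _     _      =
        second-admissible (level₂-⊔-positive a≢b) (⊔-lub (level₂≤d₂ a) (level₂≤d₂ b))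

  walkColours : ∀ {x y} → Walk (E G) x y → List (Colour n)
  walkColours w = map (uncurry colour) (edges w)

  walkColours-admissible : ∀ {x y} (w : Walk (E G) x y) → All Admissible (walkColours w)
  walkColours-admissible w = All.map⁺ (All.map colour-admissible (edges-related w))

  RainbowPath : ∀ {x y} → Walk (E G) x y → Set
  RainbowPath w = IsPath w × Unique (walkColours w)

  ColouredWithin : (Layer → Set) → ∀ {x y} → Walk (E G) x y → Set
  ColouredWithin Λ w = All (uncurry λ a b → Classified Λ a b (colour a b)) (edges w)

  rainbowPath-∷ : ∀ {Λ l x y z} (e : E G x y ≡ true) (w : Walk (E G) y z)
                → Classified (_≡ l) x y (colour x y) → ¬ Λ l → x ∉ vertices w
                → ColouredWithin Λ w → RainbowPath w → RainbowPath (e ∷ w)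
  rainbowPath-∷ {x = x} {y} e w xy ¬Λl x∉w coloured (path , rainbow) =
    All.¬Any⇒All¬ _ x∉w ∷ path , All.¬Any⇒All¬ _ fresh ∷ rainbow
    where
      fresh : colour x y ∉ walkColours w
      fresh κ∈ with ∈-map⁻ (uncurry colour) κ∈
      ... | (a , b) , ab∈ , eq =
        classified-distinct (∉⇒≢ x∉w a∈w) (∉⇒≢ x∉w b∈w) ¬Λl xy (All.lookup coloured ab∈) eq
        where
          a∈w : a ∈ vertices w
          a∈w = proj₁ (∈-edges⇒∈-vertices w ab∈)

          b∈w : b ∈ vertices w
          b∈w = proj₂ (∈-edges⇒∈-vertices w ab∈)

  prepend-prefix : ∀ {y t v l} (A : Walk (E G₁) y root) → Descending level₁ A → t ∈ vertices A
                 → (w : Walk (E G) t v) → RainbowPath w → ColouredWithin (SecondAbove l) w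
                 → (∀ {s} → s ∈ vertices w → s ≡ t ⊎ s ∉ vertices A)
                 → Σ (Walk (E G) y v) λ w′ → RainbowPath w′
                     × ColouredWithin (FirstAtMost (level₁ y)) w′
                     × (∀ {s} → s ∈ vertices w′ → s ∈ vertices A ⊎ s ∈ vertices w)
  prepend-prefix []      _ (here refl) w rainbow coloured _ =
    w , rainbow , All.map (classified-mono SecondAbove⇒FirstAtMost) coloured , inj₂
  prepend-prefix []      _ (there ())  _ _       _        _
  prepend-prefix (_ ∷ _) _ (here refl) w rainbow coloured _ =
    w , rainbow , All.map (classified-mono SecondAbove⇒FirstAtMost) coloured , inj₂
  prepend-prefix (_∷_ {y} {z} e A) (y↓z , A↓) (there t∈A) w rainbow coloured off-A
    with prepend-prefix A A↓ t∈A w rainbow coloured (Sum.map₂ (_∘ there) ∘ off-A)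
  ... | w′ , rainbow′ , coloured′ , within =
    e′ ∷ w′ , rainbowPath-∷ e′ w′ yz (<⇒≱ z<y) y∉w′ coloured′ rainbow′
            , classified-mono (λ { refl → ≤-refl }) yz
              ∷ All.map (classified-mono (FirstAtMost-mono (<⇒≤ z<y))) coloured′
            , λ { (here refl) → inj₁ (here refl) ; (there s∈) → Sum.map₁ there (within s∈) }
    where
      e′ : E G y z ≡ true
      e′ = G₁⊆G y z e

      z<y : level₁ z < level₁ y
      z<y = ≤-reflexive (sym y↓z)

      yz : Classified (_≡ first (level₁ y)) y z (colour y z)
      yz = classified-mono (λ eq → trans eq (cong first (m≥n⇒m⊔n≡m (<⇒≤ z<y)))) (classify₁ e)

      y∉A : y ∉ vertices A
      y∉A = higher∉descending level₁ A A↓ z<y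

      y∉w′ : y ∉ vertices w′
      y∉w′ y∈w′ with within y∈w′
      ... | inj₁ y∈A = y∉A y∈A
      ... | inj₂ y∈w with off-A y∈w
      ...   | inj₁ refl = y∉A t∈A
      ...   | inj₂ y∉A′ = y∉A′ (here refl)

  module Climb {u : Fin n} (A : Walk (E G₁) u root) (A↓ : Descending level₁ A) where

    open DecMembership (_≟ᶠ_ {n}) using (_∈?_)

    -- w is the reversal of the part of a G₂-geodesic from v that has been climbed so far.
    record Climbing {t v : Fin n} (w : Walk (E G) t v) : Set where
      field
        rainbow  : RainbowPath w
        coloured : ColouredWithin (SecondAbove (level₂ t)) w
        off-A    : ∀ {s} → s ∈ vertices w → s ≡ t ⊎ (level₂ t < level₂ s × s ∉ vertices A)

    climbing-[] : ∀ {v} → Climbing ([] {u = v})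
    climbing-[] = record
      { rainbow  = ([] ∷ []) , []
      ; coloured = []
      ; off-A    = λ { (here refl) → inj₁ refl ; (there ()) } }

    climbing-∷ : ∀ {t t′ v} (e : E G₂ t′ t ≡ true) → level₂ t ≡ suc (level₂ t′) → t ∉ vertices A
               → (w : Walk (E G) t v) → Climbing w → Climbing (G₂⊆G t′ t e ∷ w)
    climbing-∷ {t} {t′} e t↓t′ t∉A w c = record
      { rainbow  = rainbowPath-∷ (G₂⊆G t′ t e) w t′t (<-irrefl refl) t′∉w coloured rainbow
      ; coloured = classified-mono (λ { refl → t′<t }) t′t
                 ∷ All.map (classified-mono (SecondAbove-mono (<⇒≤ t′<t))) coloured
      ; off-A    = λ { (here refl) → inj₁ refl ; (there s∈w) → inj₂ (above s∈w) } }
      where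
        open Climbing c

        t′<t : level₂ t′ < level₂ t
        t′<t = ≤-reflexive (sym t↓t′)

        t′t : Classified (_≡ second (level₂ t)) t′ t (colour t′ t)
        t′t = classified-mono (λ eq → trans eq (cong second (m≤n⇒m⊔n≡n (<⇒≤ t′<t)))) (classify₂ e)

        t′∉w : t′ ∉ vertices w
        t′∉w t′∈w with off-A t′∈w
        ... | inj₁ refl      = <-irrefl refl t′<t
        ... | inj₂ (t<t′ , _) = <-asym t<t′ t′<t

        above : ∀ {s} → s ∈ vertices w → level₂ t′ < level₂ s × s ∉ vertices A
        above s∈w with off-A s∈w
        ... | inj₁ refl          = t′<t , t∉A
        ... | inj₂ (t<s , s∉A) = <-trans t′<t t<s , s∉A

    climb : ∀ {t v} (B : Walk (E G₂) t root) → Descending level₂ B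
          → (w : Walk (E G) t v) → Climbing w → Σ (Walk (E G) u v) RainbowPath
    climb {t} B B↓ w c with t ∈? vertices A
    ... | yes t∈A = Product.map₂ proj₁
                      (prepend-prefix A A↓ t∈A w rainbow coloured (Sum.map₂ proj₂ ∘ off-A))
      where open Climbing c
    climb []      _ _ _ | no root∉A = ⊥-elim (root∉A (target∈vertices A))
    climb (_∷_ {t} {t′} e B) (t↓t′ , B↓) w c | no t∉A =
      climb B B↓ _ (climbing-∷ (Graph.sym G₂ t t′ e) t↓t′ t∉A w c)

  rainbowPath : ∀ u v → Σ (Walk (E G) u v) RainbowPath
  rainbowPath u v = climb (geodesic₂ v) (geodesic₂-descending v) [] climbing-[]
    where open Climb (geodesic₁ u) (geodesic₁-descending u)

  module _ {c : ℕ} (common≤c : commonEdges G₁ G₂ ≤ c) where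

    encode-bounded : ∀ {a b} → E G a b ≡ true → encode (colour a b) < d₁ + d₂ + c
    encode-bounded e = <-≤-trans (encode-< (colour-admissible e)) (+-monoʳ-≤ (d₁ + d₂) pairs≤c)
      where
        pairs≤c : length commonPairs ≤ c
        pairs≤c = subst (_≤ c) (sym length-commonPairs) common≤c

    χ : EdgeColouring G (d₁ + d₂ + c)
    χ = record
      { col    = λ a b e → fromℕ< (encode-bounded e)
      ; colSym = λ a b e e′ → toℕ-injective (begin
          toℕ (fromℕ< (encode-bounded e))   ≡⟨ toℕ-fromℕ< _ ⟩
          encode (colour a b)               ≡⟨ cong encode (colour-comm a b) ⟩
          encode (colour b a)               ≡⟨ toℕ-fromℕ< _ ⟨
          toℕ (fromℕ< (encode-bounded e′))  ∎) }
      where open ≡-Reasoning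

    toℕ-colours : ∀ {x y} (w : Walk (E G) x y) → map toℕ (colours χ w) ≡ map encode (walkColours w)
    toℕ-colours []      = refl
    toℕ-colours (_ ∷ w) = cong₂ _∷_ (toℕ-fromℕ< _) (toℕ-colours w)

    χ-rainbow : IsRainbow χ
    χ-rainbow u v with rainbowPath u v
    ... | w , path , rainbow =
      w , path , Unique.map⁻ (subst Unique (sym (toℕ-colours w))
                   (unique-map⁺-on encode-injective (walkColours-admissible w) rainbow))

lemma5 : ∀ {n : ℕ} (G G₁ G₂ : Graph n) (c d₁ d₂ : ℕ)
           → SpanningSubgraph G₁ G → SpanningSubgraph G₂ G
           → Connected G₁ → Connected G₂
           → commonEdges G₁ G₂ ≤ c
           → IsDiam G₁ d₁ → IsDiam G₂ d₂
           → RcLe G (d₁ + d₂ + c)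
lemma5 G G₁ G₂ c d₁ d₂ G₁⊆G G₂⊆G _ _ common≤c diam₁ diam₂ =
  d₁ + d₂ + c , ≤-refl , χ common≤c , χ-rainbow common≤c
  where open TwoSpanningSubgraphs G G₁ G₂ G₁⊆G G₂⊆G diam₁ diam₂
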